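{- For every $n\geqslant 3$, the decycling number $D(n)$ of the bubble-sort star graph $BS_n$ satisfies \[D(n)\geqslant \frac{n!(2n-5)+2}{4n-8}.\]
   Context: For $n\geqslant 3$, the bubble-sort star graph $BS_n$ has as vertices the $n!$ permutations $(u_1u_2\ldots u_n)$ of $\{1,2,\ldots,n\}$. Let $\mathcal{T}=\{(1,2),(1,3),\ldots,(1,n),(2,3),(3,4),\ldots,(n-1,n)\}$. Two vertices are adjacent iff one is obtained from the other by swapping the entries in positions $i$ and $j$ for some $(i,j)\in\mathcal{T}$; thus $BS_n$ is $(2n-3)$-regular. A decycling set of a graph $G$ is a set $D$ of vertices such that $G\setminus D$ is acyclic; the decycling number is the minimum cardinality of a decycling set. $D(n)$ denotes the decycling number of $BS_n$. -}

module Defs where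

open import Data.Nat using (ℕ; zero; suc; _<_; _≤_)
open import Data.Fin using (Fin; toℕ; _≟_)
open import Data.Vec using (Vec; lookup; tabulate)
open import Data.List using (List; []; _∷_; length; _++_; [_])
open import Data.List.Membership.Propositional using (_∈_; _∉_)
open import Data.List.Relation.Unary.All using (All)
open import Data.List.Relation.Unary.Unique.Propositional using (Unique)
open import Data.Product using (Σ; _×_; ∃)
open import Data.Sum using (_⊎_)
open import Relation.Binary.PropositionalEquality using (_≡_)
open import Relation.Nullary.Decidable using (does)
open import Data.Bool using (if_then_else_)

-- A word of length n over Fin n; positions are 0-indexed (position k+1 of the paper = Fin index k).
Word : ℕ → Set
Word n = Vec (Fin n) n

IsPerm : ∀ {n} → Word n → Set
IsPerm {n} u = (i j : Fin n) → lookup u i ≡ lookup u j → i ≡ j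

InT : ∀ {n} → Fin n → Fin n → Set
InT i j = (toℕ i ≡ 0 × 0 < toℕ j) ⊎ (1 ≤ toℕ i × toℕ j ≡ suc (toℕ i))

swapAt : ∀ {n} → Word n → Fin n → Fin n → Word n
swapAt u i j = tabulate λ k →
  if does (k ≟ i) then lookup u j else (if does (k ≟ j) then lookup u i else lookup u k)

Adj : ∀ {n} → Word n → Word n → Set
Adj {n} u v = Σ (Fin n) λ i → Σ (Fin n) λ j → InT i j × v ≡ swapAt u i j

Walk : ∀ {n} → List (Word n) → Set
Walk [] = Data.Unit.⊤ where import Data.Unit
Walk (x ∷ []) = Data.Unit.⊤ where import Data.Unit
Walk (x ∷ y ∷ ys) = Adj x y × Walk (y ∷ ys)

CycleAvoiding : ∀ {n} → List (Word n) → List (Word n) → Set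
CycleAvoiding D [] = Data.Empty.⊥ where import Data.Empty
CycleAvoiding D (v ∷ vs) =
  3 ≤ length (v ∷ vs) × Unique (v ∷ vs) × All IsPerm (v ∷ vs) ×
  All (λ w → w ∉ D) (v ∷ vs) × Walk ((v ∷ vs) ++ [ v ])

IsVertexSet : ∀ {n} → List (Word n) → Set
IsVertexSet D = Unique D × All IsPerm D

IsDecyclingSet : (n : ℕ) → List (Word n) → Set
IsDecyclingSet n D = IsVertexSet D × ((C : List (Word n)) → CycleAvoiding D C → Data.Empty.⊥)
  where import Data.Empty

IsDecyclingNumber : ℕ → ℕ → Set
IsDecyclingNumber n d =
  (Σ (List (Word n)) λ D → IsDecyclingSet n D × length D ≡ d) ×
  ((D : List (Word n)) → IsDecyclingSet n D → d ≤ length D)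

module Submission where

-- Let F be the complement of a decycling set D in BS_n and K = 2n - 3 the degree. F induces a
-- forest, so the degrees inside F sum to at most 2|F| - 2 (strip leaves one at a time). Every
-- vertex of F has its K neighbours in F or in D, and by double counting there are at most K|D|
-- edges between F and D; hence K|F| <= 2|F| - 2 + K|D|. Substituting |F| >= n! - |D| gives
-- n!(K - 2) + 2 <= (2K - 2)|D|.

open import Defs
open import Data.Nat using (ℕ; _≤_; _*_; _+_; _∸_; _!)
open import Data.Nat using (zero; suc; _<_; z≤n; s≤s)
open import Data.Nat.Properties
open import Data.Nat.Tactic.RingSolver using (solve-∀)
open import Algebra.Properties.CommutativeSemigroup +-commutativeSemigroup using (interchange; x∙yz≈y∙xz; xy∙z≈xz∙y)
open import Data.Bool using (true; false; if_then_else_)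
open import Data.Empty using (⊥; ⊥-elim)
open import Data.Unit using (tt)
open import Data.Product using (_×_; _,_; proj₁; proj₂; ∃; ∃-syntax; uncurry)
open import Data.Sum using (inj₁; inj₂)
open import Data.Fin as Fin using (Fin; toℕ)
import Data.Fin.Properties as Finₚ
open import Data.Fin.Permutation.Components using (transpose)
open import Data.List using (List; []; _∷_; length; _++_; [_]; filter; map; concatMap; allFin)
open import Data.List.Properties using (length-tabulate; ++-assoc; length-++; length-map; filter-notAll; filter-all; filter-accept; filter-reject)
open import Data.List.Membership.Propositional using (_∈_; _∉_; find)
open import Data.List.Membership.Propositional.Properties using (∈-filter⁻; ∈-filter⁺; ∈-∃++; ∈-++⁻; ∈-allFin; ∈-map⁺; ∈-map⁻; ∈-concatMap⁺; ∈-concatMap⁻)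
import Data.List.Membership.DecPropositional as DecMembership
open import Data.List.Relation.Unary.All as All using (All; []; _∷_)
import Data.List.Relation.Unary.All.Properties as Allₚ
open import Data.List.Relation.Unary.Any as Any using (here; there)
import Data.List.Relation.Unary.AllPairs as AllPairs
import Data.List.Relation.Unary.AllPairs.Properties as AllPairsₚ
open import Data.List.Relation.Unary.Linked as Linked using (Linked; []; [-]; _∷_)
open import Data.List.Relation.Unary.Unique.Propositional using (Unique; []; _∷_)
import Data.List.Relation.Unary.Unique.Propositional.Properties as Unique
open import Data.List.Relation.Binary.Disjoint.Propositional using (Disjoint)
open import Data.Vec as Vec using (Vec)
import Data.Vec.Properties as Vecₚ
import Data.Vec.Relation.Unary.All as VecAll
import Data.Vec.Relation.Unary.All.Properties as VecAllₚ
import Data.Vec.Relation.Unary.Unique.Propositional as VecUnique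
import Data.Vec.Relation.Unary.Unique.Propositional.Properties as VecUniqueₚ
open import Function using (_∘_; id)
open import Relation.Nullary using (Dec; yes; no; ¬?; does)
open import Relation.Unary using (Decidable)
open import Relation.Binary.Definitions using (DecidableEquality)
open import Relation.Binary.PropositionalEquality hiding ([_])

private
  variable
    A B : Set

∑ : List A → (A → ℕ) → ℕ
∑ []       f = 0
∑ (x ∷ xs) f = f x + ∑ xs f

syntax ∑ xs (λ x → e) = ∑[ x ∈ xs ] e

𝟙 : {P : Set} → Dec P → ℕ
𝟙 (yes _) = 1
𝟙 (no _)  = 0

∑-cong : ∀ {f g : A → ℕ} xs → (∀ {x} → x ∈ xs → f x ≡ g x) → ∑ xs f ≡ ∑ xs g
∑-cong []       f≡g = refl
∑-cong (x ∷ xs) f≡g = cong₂ _+_ (f≡g (here refl)) (∑-cong xs (f≡g ∘ there))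

∑-mono-≤ : ∀ {f g : A → ℕ} xs → (∀ {x} → x ∈ xs → f x ≤ g x) → ∑ xs f ≤ ∑ xs g
∑-mono-≤ []       f≤g = z≤n
∑-mono-≤ (x ∷ xs) f≤g = +-mono-≤ (f≤g (here refl)) (∑-mono-≤ xs (f≤g ∘ there))

∑-distrib-+ : ∀ (f g : A → ℕ) xs → ∑[ x ∈ xs ] (f x + g x) ≡ ∑ xs f + ∑ xs g
∑-distrib-+ f g []       = refl
∑-distrib-+ f g (x ∷ xs) =
  trans (cong (f x + g x +_) (∑-distrib-+ f g xs)) (interchange (f x) (g x) (∑ xs f) (∑ xs g))

∑-const : ∀ c (xs : List A) → ∑[ x ∈ xs ] c ≡ length xs * c
∑-const c []       = refl
∑-const c (x ∷ xs) = cong (c +_) (∑-const c xs)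

length≡∑1 : (xs : List A) → length xs ≡ ∑[ x ∈ xs ] 1
length≡∑1 xs = sym (trans (∑-const 1 xs) (*-identityʳ (length xs)))

∑-comm : ∀ (f : A → B → ℕ) xs ys → ∑[ x ∈ xs ] ∑[ y ∈ ys ] f x y ≡ ∑[ y ∈ ys ] ∑[ x ∈ xs ] f x y
∑-comm f []       ys = sym (trans (∑-const 0 ys) (*-zeroʳ (length ys)))
∑-comm f (x ∷ xs) ys =
  trans (cong (∑ ys (f x) +_) (∑-comm f xs ys)) (sym (∑-distrib-+ (f x) (λ y → ∑[ x ∈ xs ] f x y) ys))

∑𝟙≡length∘filter : ∀ {P : A → Set} (P? : Decidable P) xs → ∑[ x ∈ xs ] 𝟙 (P? x) ≡ length (filter P? xs)
∑𝟙≡length∘filter P? []       = refl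
∑𝟙≡length∘filter P? (x ∷ xs) with P? x
... | yes _ = cong suc (∑𝟙≡length∘filter P? xs)
... | no _  = ∑𝟙≡length∘filter P? xs

𝟙≤1 : ∀ {P : Set} (P? : Dec P) → 𝟙 P? ≤ 1
𝟙≤1 (yes _) = s≤s z≤n
𝟙≤1 (no _)  = z≤n

∑𝟙≤length : ∀ {P : A → Set} (P? : Decidable P) xs → ∑[ x ∈ xs ] 𝟙 (P? x) ≤ length xs
∑𝟙≤length P? xs = subst (∑[ x ∈ xs ] 𝟙 (P? x) ≤_) (sym (length≡∑1 xs)) (∑-mono-≤ xs (λ {x} _ → 𝟙≤1 (P? x)))

𝟙-mono : ∀ {P Q : Set} (P? : Dec P) (Q? : Dec Q) → (P → Q) → 𝟙 P? ≤ 𝟙 Q?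
𝟙-mono (yes _) (yes _) _   = ≤-refl
𝟙-mono (yes p) (no ¬q) P⇒Q = ⊥-elim (¬q (P⇒Q p))
𝟙-mono (no _)  _       _   = z≤n

𝟙-yes : ∀ {P : Set} (P? : Dec P) → P → 𝟙 P? ≡ 1
𝟙-yes (yes _) _ = refl
𝟙-yes (no ¬p) p = ⊥-elim (¬p p)

𝟙¬?+𝟙≡1 : ∀ {P : Set} (P? : Dec P) → 𝟙 (¬? P?) + 𝟙 P? ≡ 1
𝟙¬?+𝟙≡1 (yes _) = refl
𝟙¬?+𝟙≡1 (no _)  = refl

length-concatMap : ∀ (f : A → List B) xs → length (concatMap f xs) ≡ ∑[ x ∈ xs ] length (f x)
length-concatMap f []       = refl
length-concatMap f (x ∷ xs) = trans (length-++ (f x)) (cong (length (f x) +_) (length-concatMap f xs))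

Unique-++⁻ˡ : ∀ (xs : List A) {ys} → Unique (xs ++ ys) → Unique xs
Unique-++⁻ˡ []       _            = []
Unique-++⁻ˡ (x ∷ xs) (x∉ ∷ uniq) = Allₚ.++⁻ˡ xs x∉ ∷ Unique-++⁻ˡ xs uniq

Unique-map⁺ : ∀ {f : A → B} {xs} → (∀ {x y} → x ∈ xs → y ∈ xs → f x ≡ f y → x ≡ y) → Unique xs → Unique (map f xs)
Unique-map⁺ {xs = []}     _         []           = []
Unique-map⁺ {f = f} {xs = x ∷ xs} injective (x∉ ∷ uniq) =
  All.tabulate fx∉ ∷ Unique-map⁺ (λ p q → injective (there p) (there q)) uniq
  where
  fx∉ : ∀ {z} → z ∈ map f xs → f x ≢ z
  fx∉ z∈ fx≡z with ∈-map⁻ f z∈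
  ... | y , y∈xs , refl = All.lookup x∉ y∈xs (injective (here refl) (there y∈xs) fx≡z)

Linked-++⁻ˡ : ∀ {R : A → A → Set} xs {ys} → Linked R (xs ++ ys) → Linked R xs
Linked-++⁻ˡ []           _          = []
Linked-++⁻ˡ (x ∷ [])     _          = [-]
Linked-++⁻ˡ (x ∷ y ∷ xs) (r ∷ rs) = r ∷ Linked-++⁻ˡ (y ∷ xs) rs

Linked-∷ʳ : ∀ {R : A → A → Set} xs {y z} → Linked R (xs ++ [ y ]) → R y z → Linked R ((xs ++ [ y ]) ++ [ z ])
Linked-∷ʳ []           _          ryz = ryz ∷ [-]
Linked-∷ʳ (x ∷ [])     (rxy ∷ _)  ryz = rxy ∷ ryz ∷ [-]
Linked-∷ʳ (x ∷ x′ ∷ xs) (r ∷ rs)  ryz = r ∷ Linked-∷ʳ (x′ ∷ xs) rs ryz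

module DecidableLists {A : Set} (_≟_ : DecidableEquality A) where

  open DecMembership _≟_ public using (_∈?_)

  _without_ : List A → A → List A
  xs without v = filter (λ w → ¬? (w ≟ v)) xs

  _∖_ : List A → List A → List A
  xs ∖ ys = filter (λ w → ¬? (w ∈? ys)) xs

  ∈-without⁻ : ∀ {v w} xs → w ∈ xs without v → w ∈ xs × w ≢ v
  ∈-without⁻ {v} xs = ∈-filter⁻ (λ w → ¬? (w ≟ v)) {xs = xs}

  ∈-without⁺ : ∀ {v w xs} → w ∈ xs → w ≢ v → w ∈ xs without v
  ∈-without⁺ {v} = ∈-filter⁺ (λ w → ¬? (w ≟ v))

  without-unique : ∀ {v xs} → Unique xs → Unique (xs without v)
  without-unique {v} = Unique.filter⁺ (λ w → ¬? (w ≟ v))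

  ∈-∖⁻ : ∀ {w} xs {ys} → w ∈ xs ∖ ys → w ∈ xs × w ∉ ys
  ∈-∖⁻ xs {ys} = ∈-filter⁻ (λ w → ¬? (w ∈? ys)) {xs = xs}

  ∈-∖⁺ : ∀ {w xs ys} → w ∈ xs → w ∉ ys → w ∈ xs ∖ ys
  ∈-∖⁺ {ys = ys} = ∈-filter⁺ (λ w → ¬? (w ∈? ys))

  ∖-unique : ∀ {xs} ys → Unique xs → Unique (xs ∖ ys)
  ∖-unique ys = Unique.filter⁺ (λ w → ¬? (w ∈? ys))

  Unique⇒length-≤ : ∀ {xs ys} → Unique xs → (∀ {x} → x ∈ xs → x ∈ ys) → length xs ≤ length ys
  Unique⇒length-≤ {[]}     _            _     = z≤n
  Unique⇒length-≤ {x ∷ xs} {ys} (x∉ ∷ uniq) xs⊆ys = begin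
    suc (length xs)             ≤⟨ s≤s (Unique⇒length-≤ uniq xs⊆ys-without-x) ⟩
    suc (length (ys without x)) ≤⟨ filter-notAll (λ w → ¬? (w ≟ x)) ys (Any.map (λ x≡y x≢y → x≢y (sym x≡y)) (xs⊆ys (here refl))) ⟩
    length ys                   ∎
    where
    open ≤-Reasoning
    xs⊆ys-without-x : ∀ {y} → y ∈ xs → y ∈ ys without x
    xs⊆ys-without-x y∈xs = ∈-without⁺ (xs⊆ys (there y∈xs)) (λ y≡x → All.lookup x∉ y∈xs (sym y≡x))

  Unique⇒∃≢ : ∀ {xs} → Unique xs → 2 ≤ length xs → ∀ x → ∃[ y ] y ∈ xs × y ≢ x
  Unique⇒∃≢ {_ ∷ []}    _                 (s≤s ()) _
  Unique⇒∃≢ {a ∷ b ∷ _} ((a≢b ∷ _) ∷ _) _ x with a ≟ x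
  ... | yes refl = b , there (here refl) , λ b≡a → a≢b (sym b≡a)
  ... | no a≢x   = a , here refl , a≢x

  count-∈-≤ : ∀ {xs} ys → Unique xs → ∑[ x ∈ xs ] 𝟙 (x ∈? ys) ≤ ∑[ y ∈ ys ] 𝟙 (y ∈? xs)
  count-∈-≤ {xs} ys uniq = begin
    ∑[ x ∈ xs ] 𝟙 (x ∈? ys)      ≡⟨ ∑𝟙≡length∘filter (_∈? ys) xs ⟩
    length (filter (_∈? ys) xs) ≤⟨ Unique⇒length-≤ (Unique.filter⁺ (_∈? ys) uniq) swap-filter ⟩
    length (filter (_∈? xs) ys) ≡⟨ ∑𝟙≡length∘filter (_∈? xs) ys ⟨
    ∑[ y ∈ ys ] 𝟙 (y ∈? xs)      ∎
    where
    open ≤-Reasoning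
    swap-filter : ∀ {z} → z ∈ filter (_∈? ys) xs → z ∈ filter (_∈? xs) ys
    swap-filter z∈ = let (z∈xs , z∈ys) = ∈-filter⁻ (_∈? ys) {xs = xs} z∈ in ∈-filter⁺ (_∈? xs) z∈ys z∈xs

  ∑-without : ∀ (f : A → ℕ) {v xs} → Unique xs → v ∈ xs → ∑ xs f ≡ f v + ∑ (xs without v) f
  ∑-without f {v} {x ∷ xs} (x∉ ∷ _) (here refl) = cong (λ ys → f v + ∑ ys f) (sym (begin
    (v ∷ xs) without v ≡⟨ filter-reject (λ w → ¬? (w ≟ v)) (λ v≢v → v≢v refl) ⟩
    xs without v       ≡⟨ filter-all (λ w → ¬? (w ≟ v)) (All.map (λ v≢w w≡v → v≢w (sym w≡v)) x∉) ⟩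
    xs                 ∎))
    where open ≡-Reasoning
  ∑-without f {v} {x ∷ xs} (x∉ ∷ uniq) (there v∈xs) = begin
    f x + ∑ xs f                     ≡⟨ cong (f x +_) (∑-without f uniq v∈xs) ⟩
    f x + (f v + ∑ (xs without v) f) ≡⟨ x∙yz≈y∙xz (f x) (f v) _ ⟩
    f v + (f x + ∑ (xs without v) f) ≡⟨ cong (λ ys → f v + ∑ ys f) (filter-accept (λ w → ¬? (w ≟ v)) (All.lookup x∉ v∈xs)) ⟨
    f v + ∑ ((x ∷ xs) without v) f   ∎
    where open ≡-Reasoning

  length-without : ∀ {v xs} → Unique xs → v ∈ xs → length xs ≡ suc (length (xs without v))
  length-without {v} {xs} uniq v∈xs = begin
    length xs                      ≡⟨ length≡∑1 xs ⟩
    ∑[ x ∈ xs ] 1                  ≡⟨ ∑-without (λ _ → 1) uniq v∈xs ⟩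
    suc (∑[ x ∈ xs without v ] 1)  ≡⟨ cong suc (length≡∑1 (xs without v)) ⟨
    suc (length (xs without v))    ∎
    where open ≡-Reasoning

-- Acyclic vertex sets of a graph

module Graph {A : Set} (_≟_ : DecidableEquality A) (N : A → List A)
             (N-sym : ∀ {v w} → w ∈ N v → v ∈ N w) where

  open DecidableLists _≟_

  _~_ : A → A → Set
  v ~ w = w ∈ N v

  deg : List A → A → ℕ
  deg S v = ∑[ w ∈ S ] 𝟙 (w ∈? N v)

  IsCycleIn : List A → List A → Set
  IsCycleIn S []       = ⊥
  IsCycleIn S (v ∷ vs) =
    3 ≤ length (v ∷ vs) × Unique (v ∷ vs) × All (_∈ S) (v ∷ vs) × Linked _~_ ((v ∷ vs) ++ [ v ])

  Acyclic : List A → Set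
  Acyclic S = ∀ C → IsCycleIn S C → ⊥

  Acyclic-⊆ : ∀ {S T} → (∀ {v} → v ∈ T → v ∈ S) → Acyclic S → Acyclic T
  Acyclic-⊆ T⊆S acyclic []       ()
  Acyclic-⊆ T⊆S acyclic (v ∷ vs) (len , uniq , inT , linked) = acyclic (v ∷ vs) (len , uniq , All.map T⊆S inT , linked)

  module _ (S : List A) (S-unique : Unique S) (irreflexive : ∀ {v} → v ∈ S → v ∉ N v) where

    another-neighbour : ∀ {v} → 2 ≤ deg S v → ∀ x → ∃[ w ] w ∈ S × v ~ w × w ≢ x
    another-neighbour {v} 2≤deg x =
      let (w , w∈ , w≢x) = Unique⇒∃≢ (Unique.filter⁺ (_∈? N v) S-unique)
                                     (subst (2 ≤_) (∑𝟙≡length∘filter (_∈? N v) S) 2≤deg) x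
          (w∈S , v~w) = ∈-filter⁻ (_∈? N v) {xs = S} w∈
      in w , w∈S , v~w , w≢x

    close-cycle : ∀ {x y w} pre post → Unique (x ∷ y ∷ pre ++ w ∷ post) → All (_∈ S) (x ∷ y ∷ pre ++ w ∷ post) →
                  Linked _~_ (x ∷ y ∷ pre ++ w ∷ post) → w ~ x → IsCycleIn S (x ∷ y ∷ pre ++ [ w ])
    close-cycle {x} {y} {w} pre post uniq inS linked w~x =
      s≤s (s≤s (subst (1 ≤_) (sym (length-++ pre)) (m≤n+m 1 (length pre)))) ,
      Unique-++⁻ˡ (path ++ [ w ]) (subst Unique split uniq) ,
      Allₚ.++⁻ˡ (path ++ [ w ]) (subst (All (_∈ S)) split inS) ,
      Linked-∷ʳ path (Linked-++⁻ˡ (path ++ [ w ]) (subst (Linked _~_) split linked)) w~x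
      where
      path : List A
      path = x ∷ y ∷ pre
      split : path ++ w ∷ post ≡ (path ++ [ w ]) ++ post
      split = sym (++-assoc path [ w ] post)

    module _ (deg≥2 : All (λ v → 2 ≤ deg S v) S) where

      -- Minimum degree 2 gives a neighbour w of the front
      -- vertex other than its successor; if w is already on the path, the segment up to w closes a
      -- cycle. A duplicate-free path in S has at most |S| vertices, so fuel |S| suffices.
      extend-path : ∀ fuel {v₀ v₁} vs → length S < length (v₀ ∷ v₁ ∷ vs) + fuel →
                    Unique (v₀ ∷ v₁ ∷ vs) → All (_∈ S) (v₀ ∷ v₁ ∷ vs) → Linked _~_ (v₀ ∷ v₁ ∷ vs) →
                    ∃ (IsCycleIn S)
      extend-path zero vs short uniq inS _ =
        ⊥-elim (<⇒≱ (subst (length S <_) (+-identityʳ _) short) (Unique⇒length-≤ uniq (All.lookup inS)))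
      extend-path (suc fuel) {v₀} {v₁} vs short uniq inS linked
        with another-neighbour (All.lookup deg≥2 (All.lookup inS (here refl))) v₁
      ... | w , w∈S , v₀~w , w≢v₁ with w ∈? (v₀ ∷ v₁ ∷ vs)
      ...   | no w∉path = extend-path fuel (v₁ ∷ vs) (subst (length S <_) (+-suc _ fuel) short)
                            (All.tabulate (λ {z} z∈path w≡z → w∉path (subst (_∈ _) (sym w≡z) z∈path)) ∷ uniq)
                            (w∈S ∷ inS) (N-sym v₀~w ∷ linked)
      ...   | yes w∈path with ∈-∃++ w∈path
      ...     | []         , post , refl = ⊥-elim (irreflexive w∈S v₀~w)
      ...     | _ ∷ []     , post , refl = ⊥-elim (w≢v₁ refl)
      ...     | _ ∷ _ ∷ pre , post , refl = _ , close-cycle pre post uniq inS linked (N-sym v₀~w)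

      deg≥2⇒cycle : ∀ {s} → s ∈ S → ∃ (IsCycleIn S)
      deg≥2⇒cycle {s} s∈S with another-neighbour (All.lookup deg≥2 s∈S) s
      ... | w , w∈S , s~w , w≢s =
        extend-path (length S) [] (s≤s (n≤1+n (length S))) ((w≢s ∷ []) ∷ [] ∷ []) (w∈S ∷ s∈S ∷ []) (N-sym s~w ∷ [-])

    acyclic⇒leaf : Acyclic S → ∀ {s} → s ∈ S → ∃[ v ] v ∈ S × deg S v ≤ 1
    acyclic⇒leaf acyclic s∈S with Any.any? (λ v → deg S v ≤? 1) S
    ... | yes leaf = find leaf
    ... | no ¬leaf = ⊥-elim (acyclic _ (proj₂ (deg≥2⇒cycle deg≥2 s∈S)))
      where
      deg≥2 : All (λ v → 2 ≤ deg S v) S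
      deg≥2 = All.tabulate (λ v∈S → ≰⇒> (λ deg≤1 → ¬leaf (Any.map (λ { refl → deg≤1 }) v∈S)))

  -- Deleting a leaf v removes deg v <= 1 from its own term and at most 1 from the other terms.
  acyclic⇒∑deg≤ : ∀ k S → length S ≡ suc k → Unique S → (∀ {v} → v ∈ S → v ∉ N v) → Acyclic S →
                  ∑[ v ∈ S ] deg S v + 2 ≤ 2 * length S
  acyclic⇒∑deg≤ zero (s ∷ []) _ _ irreflexive _ with s ∈? N s
  ... | yes s~s = ⊥-elim (irreflexive (here refl) s~s)
  ... | no _    = ≤-refl
  acyclic⇒∑deg≤ (suc k) S@(_ ∷ _) len uniq irreflexive acyclic
    with acyclic⇒leaf S uniq irreflexive acyclic (here refl)
  ... | v , v∈S , deg≤1 = begin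
    ∑[ w ∈ S ] deg S w + 2                             ≡⟨ cong (_+ 2) (∑-without (deg S) uniq v∈S) ⟩
    deg S v + ∑[ w ∈ S′ ] deg S w + 2                  ≡⟨ cong (λ z → deg S v + z + 2) ∑deg-split ⟩
    deg S v + (∑[ w ∈ S′ ] 𝟙 (v ∈? N w) + ∑[ w ∈ S′ ] deg S′ w) + 2
                                                       ≤⟨ +-monoˡ-≤ 2 (+-mono-≤ deg≤1 (+-monoˡ-≤ _ edges-to-v≤1)) ⟩
    2 + (∑[ w ∈ S′ ] deg S′ w + 2)                     ≤⟨ +-monoʳ-≤ 2 (acyclic⇒∑deg≤ k S′ len′ uniq′ irreflexive′ acyclic′) ⟩
    2 + 2 * length S′                                  ≡⟨ *-suc 2 (length S′) ⟨
    2 * suc (length S′)                                ≡⟨ cong (2 *_) (length-without uniq v∈S) ⟨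
    2 * length S                                       ∎
    where
    open ≤-Reasoning
    S′ : List A
    S′ = S without v
    S′⊆S : ∀ {w} → w ∈ S′ → w ∈ S
    S′⊆S = proj₁ ∘ ∈-without⁻ S
    len′ : length S′ ≡ suc k
    len′ = suc-injective (trans (sym (length-without uniq v∈S)) len)
    uniq′ : Unique S′
    uniq′ = without-unique uniq
    irreflexive′ : ∀ {w} → w ∈ S′ → w ∉ N w
    irreflexive′ = irreflexive ∘ S′⊆S
    acyclic′ : Acyclic S′
    acyclic′ = Acyclic-⊆ S′⊆S acyclic
    deg-without : ∀ w → deg S w ≡ 𝟙 (v ∈? N w) + deg S′ w
    deg-without w = ∑-without (λ x → 𝟙 (x ∈? N w)) uniq v∈S
    ∑deg-split : ∑[ w ∈ S′ ] deg S w ≡ ∑[ w ∈ S′ ] 𝟙 (v ∈? N w) + ∑[ w ∈ S′ ] deg S′ w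
    ∑deg-split = trans (∑-cong S′ (λ {w} _ → deg-without w)) (∑-distrib-+ (λ w → 𝟙 (v ∈? N w)) (deg S′) S′)
    edges-to-v≤1 : ∑[ w ∈ S′ ] 𝟙 (v ∈? N w) ≤ 1
    edges-to-v≤1 = begin
      ∑[ w ∈ S′ ] 𝟙 (v ∈? N w) ≤⟨ ∑-mono-≤ S′ (λ {w} _ → 𝟙-mono (v ∈? N w) (w ∈? N v) N-sym) ⟩
      deg S′ v                ≤⟨ m≤n+m (deg S′ v) _ ⟩
      𝟙 (v ∈? N v) + deg S′ v ≡⟨ deg-without v ⟨
      deg S v                 ≤⟨ deg≤1 ⟩
      1                       ∎

  deg≤length : ∀ {S} v → Unique S → deg S v ≤ length (N v)
  deg≤length {S} v uniq = ≤-trans (count-∈-≤ (N v) uniq) (∑𝟙≤length (_∈? S) (N v))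

  module RegularGraph (V : List A) (V-unique : Unique V) (k : ℕ)
         (N-closed : ∀ {v w} → v ∈ V → v ~ w → w ∈ V)
         (N-irreflexive : ∀ {v} → v ∈ V → v ∉ N v)
         (N-unique : ∀ {v} → v ∈ V → Unique (N v))
         (N-regular : ∀ {v} → v ∈ V → length (N v) ≡ 2 + k)
         (D : List A) (D⊆V : All (_∈ V) D) where

    F : List A
    F = V ∖ D

    F-unique : Unique F
    F-unique = ∖-unique D V-unique

    length-V≤ : length V ≤ length F + length D
    length-V≤ = begin
      length V                                   ≡⟨ length≡∑1 V ⟩
      ∑[ v ∈ V ] 1                               ≡⟨ ∑-cong V (λ {v} _ → 𝟙¬?+𝟙≡1 (v ∈? D)) ⟨
      ∑[ v ∈ V ] (𝟙 (¬? (v ∈? D)) + 𝟙 (v ∈? D))  ≡⟨ ∑-distrib-+ (λ v → 𝟙 (¬? (v ∈? D))) (λ v → 𝟙 (v ∈? D)) V ⟩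
      ∑[ v ∈ V ] 𝟙 (¬? (v ∈? D)) + ∑[ v ∈ V ] 𝟙 (v ∈? D)
        ≤⟨ +-mono-≤ (≤-reflexive (∑𝟙≡length∘filter (λ v → ¬? (v ∈? D)) V))
                    (≤-trans (count-∈-≤ D V-unique) (∑𝟙≤length (_∈? V) D)) ⟩
      length F + length D                        ∎
      where open ≤-Reasoning

    regular≤deg+deg : ∀ {v} → v ∈ V → 2 + k ≤ deg F v + deg D v
    regular≤deg+deg {v} v∈V = begin
      2 + k                                          ≡⟨ N-regular v∈V ⟨
      length (N v)                                   ≡⟨ length≡∑1 (N v) ⟩
      ∑[ w ∈ N v ] 1                                 ≤⟨ ∑-mono-≤ (N v) in-F-or-D ⟩
      ∑[ w ∈ N v ] (𝟙 (w ∈? F) + 𝟙 (w ∈? D))         ≡⟨ ∑-distrib-+ (λ w → 𝟙 (w ∈? F)) (λ w → 𝟙 (w ∈? D)) (N v) ⟩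
      ∑[ w ∈ N v ] 𝟙 (w ∈? F) + ∑[ w ∈ N v ] 𝟙 (w ∈? D)
        ≤⟨ +-mono-≤ (count-∈-≤ F (N-unique v∈V)) (count-∈-≤ D (N-unique v∈V)) ⟩
      deg F v + deg D v                              ∎
      where
      open ≤-Reasoning
      in-F-or-D : ∀ {w} → v ~ w → 1 ≤ 𝟙 (w ∈? F) + 𝟙 (w ∈? D)
      in-F-or-D {w} v~w with w ∈? D
      ... | yes _   = m≤n+m 1 _
      ... | no w∉D  = ≤-trans (≤-reflexive (sym (𝟙-yes (w ∈? F) (∈-∖⁺ (N-closed v∈V v~w) w∉D)))) (m≤m+n _ 0)

    -- Double counting of the edges between F and D, counted from the side of D.
    ∑deg-D≤ : ∑[ v ∈ F ] deg D v ≤ length D * (2 + k)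
    ∑deg-D≤ = begin
      ∑[ v ∈ F ] ∑[ w ∈ D ] 𝟙 (w ∈? N v)   ≡⟨ ∑-comm (λ v w → 𝟙 (w ∈? N v)) F D ⟩
      ∑[ w ∈ D ] ∑[ v ∈ F ] 𝟙 (w ∈? N v)   ≤⟨ ∑-mono-≤ D (λ {w} _ → ∑-mono-≤ F (λ {v} _ → 𝟙-mono (w ∈? N v) (v ∈? N w) N-sym)) ⟩
      ∑[ w ∈ D ] deg F w                   ≤⟨ ∑-mono-≤ D (λ {w} w∈D → subst (deg F w ≤_) (N-regular (All.lookup D⊆V w∈D)) (deg≤length w F-unique)) ⟩
      ∑[ w ∈ D ] (2 + k)                   ≡⟨ ∑-const (2 + k) D ⟩
      length D * (2 + k)                   ∎
      where open ≤-Reasoning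

    ∑deg-F-regular : length F * (2 + k) ≤ ∑[ v ∈ F ] deg F v + ∑[ v ∈ F ] deg D v
    ∑deg-F-regular = begin
      length F * (2 + k)                           ≡⟨ ∑-const (2 + k) F ⟨
      ∑[ v ∈ F ] (2 + k)                           ≤⟨ ∑-mono-≤ F (regular≤deg+deg ∘ proj₁ ∘ ∈-∖⁻ V) ⟩
      ∑[ v ∈ F ] (deg F v + deg D v)               ≡⟨ ∑-distrib-+ (deg F) (deg D) F ⟩
      ∑[ v ∈ F ] deg F v + ∑[ v ∈ F ] deg D v      ∎
      where open ≤-Reasoning

    forest-bound : ∀ {f} → length F ≡ suc f → Acyclic F → length F * k + 2 ≤ length D * (2 + k)
    forest-bound {f} |F|≡ acyclic = +-cancelˡ-≤ (2 * length F) _ _ (begin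
      2 * length F + (length F * k + 2)              ≡⟨ rearrange (length F) k ⟩
      length F * (2 + k) + 2                         ≤⟨ +-monoˡ-≤ 2 ∑deg-F-regular ⟩
      ∑[ v ∈ F ] deg F v + ∑[ v ∈ F ] deg D v + 2    ≡⟨ xy∙z≈xz∙y (∑[ v ∈ F ] deg F v) _ 2 ⟩
      ∑[ v ∈ F ] deg F v + 2 + ∑[ v ∈ F ] deg D v    ≤⟨ +-mono-≤ forest ∑deg-D≤ ⟩
      2 * length F + length D * (2 + k)              ∎)
      where
      open ≤-Reasoning
      forest : ∑[ v ∈ F ] deg F v + 2 ≤ 2 * length F
      forest = acyclic⇒∑deg≤ f F |F|≡ F-unique (N-irreflexive ∘ proj₁ ∘ ∈-∖⁻ V) acyclic
      rearrange : ∀ f k → 2 * f + (f * k + 2) ≡ f * (2 + k) + 2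
      rearrange = solve-∀

    acyclic⇒bound : 0 < length V → Acyclic F → length F * k + 2 ≤ length D * (2 + k)
    acyclic⇒bound 0<|V| acyclic with length F in |F|≡
    ... | suc f = subst (λ l → l * k + 2 ≤ length D * (2 + k)) |F|≡ (forest-bound |F|≡ acyclic)
    ... | zero  = begin
      2                   ≤⟨ m≤m+n 2 k ⟩
      2 + k               ≡⟨ *-identityˡ (2 + k) ⟨
      1 * (2 + k)         ≤⟨ *-monoˡ-≤ (2 + k) (≤-trans 0<|V| (subst (λ f → length V ≤ f + length D) |F|≡ length-V≤)) ⟩
      length D * (2 + k)  ∎
      where open ≤-Reasoning

    decycling-bound : 0 < length V → Acyclic F → length V * k + 2 ≤ length D * (2 + 2 * k)
    decycling-bound 0<|V| acyclic = begin
      length V * k + 2                   ≤⟨ +-monoˡ-≤ 2 (*-monoˡ-≤ k length-V≤) ⟩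
      (length F + length D) * k + 2      ≡⟨ split-F (length F) (length D) k ⟩
      length F * k + 2 + length D * k    ≤⟨ +-monoˡ-≤ (length D * k) (acyclic⇒bound 0<|V| acyclic) ⟩
      length D * (2 + k) + length D * k  ≡⟨ merge-D (length D) k ⟩
      length D * (2 + 2 * k)             ∎
      where
      open ≤-Reasoning
      split-F : ∀ f d k → (f + d) * k + 2 ≡ f * k + 2 + d * k
      split-F = solve-∀
      merge-D : ∀ d k → d * (2 + k) + d * k ≡ d * (2 + 2 * k)
      merge-D = solve-∀

-- Enumerating duplicate-free vectors

lookup-injective⇒Unique : ∀ {k} (v : Vec A k) → (∀ i j → Vec.lookup v i ≡ Vec.lookup v j → i ≡ j) → VecUnique.Unique v
lookup-injective⇒Unique Vec.[]      _         = VecUnique.[]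
lookup-injective⇒Unique (x Vec.∷ v) injective =
  VecAllₚ.lookup⁻ (λ i x≡ → Finₚ.0≢1+n (injective Fin.zero (Fin.suc i) x≡)) VecUnique.∷
  lookup-injective⇒Unique v (λ i j eq → Finₚ.suc-injective (injective (Fin.suc i) (Fin.suc j) eq))

module Arrangements {A : Set} (_≟_ : DecidableEquality A) where

  open DecidableLists _≟_

  arrangements : (k : ℕ) → List A → List (Vec A k)
  arrangements zero    xs = [ Vec.[] ]
  arrangements (suc k) xs = concatMap (λ x → map (x Vec.∷_) (arrangements k (xs without x))) xs

  length-arrangements : ∀ k xs → Unique xs → length xs ≡ k → length (arrangements k xs) ≡ k !
  length-arrangements zero    xs _    _   = refl
  length-arrangements (suc k) xs uniq len = begin
    length (arrangements (suc k) xs)                                       ≡⟨ length-concatMap _ xs ⟩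
    ∑[ x ∈ xs ] length (map (x Vec.∷_) (arrangements k (xs without x)))    ≡⟨ ∑-cong xs (λ {x} x∈xs → trans (length-map (x Vec.∷_) (arrangements k (xs without x))) (IH x∈xs)) ⟩
    ∑[ x ∈ xs ] (k !)                                                      ≡⟨ ∑-const (k !) xs ⟩
    length xs * k !                                                        ≡⟨ cong (_* k !) len ⟩
    suc k !                                                                ∎
    where
    open ≡-Reasoning
    IH : ∀ {x} → x ∈ xs → length (arrangements k (xs without x)) ≡ k !
    IH x∈xs = length-arrangements k _ (without-unique uniq) (suc-injective (trans (sym (length-without uniq x∈xs)) len))

  arrangements-unique : ∀ k xs → Unique xs → Unique (arrangements k xs)
  arrangements-unique zero    xs _    = [] ∷ []
  arrangements-unique (suc k) xs uniq =
    Unique.concat⁺ (Allₚ.map⁺ (All.tabulate (λ _ → Unique.map⁺ Vecₚ.∷-injectiveʳ (arrangements-unique k _ (without-unique uniq)))))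
                   (AllPairsₚ.map⁺ (AllPairs.map heads-differ uniq))
    where
    heads-differ : ∀ {x y} {us vs : List (Vec A k)} → x ≢ y → Disjoint (map (x Vec.∷_) us) (map (y Vec.∷_) vs)
    heads-differ x≢y (p , q) with ∈-map⁻ _ p | ∈-map⁻ _ q
    ... | _ , _ , refl | _ , _ , eq = x≢y (Vecₚ.∷-injectiveˡ eq)

  arrangements-sound : ∀ k xs {v : Vec A k} → v ∈ arrangements k xs → VecUnique.Unique v × VecAll.All (_∈ xs) v
  arrangements-sound zero    xs (here refl) = VecUnique.[] , VecAll.[]
  arrangements-sound (suc k) xs v∈ with find (∈-concatMap⁻ (λ x → map (x Vec.∷_) (arrangements k (xs without x))) {xs = xs} v∈)
  ... | x , x∈xs , v∈map with ∈-map⁻ (x Vec.∷_) v∈map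
  ...   | w , w∈ , refl with arrangements-sound k (xs without x) w∈
  ...     | w-unique , w⊆xs-x =
    VecAll.map (λ w∈ x≡ → proj₂ (∈-without⁻ xs w∈) (sym x≡)) w⊆xs-x VecUnique.∷ w-unique ,
    x∈xs VecAll.∷ VecAll.map (proj₁ ∘ ∈-without⁻ xs) w⊆xs-x

  arrangements-complete : ∀ k xs {v : Vec A k} → VecUnique.Unique v → VecAll.All (_∈ xs) v → v ∈ arrangements k xs
  arrangements-complete zero    xs {Vec.[]}    _                            _                    = here refl
  arrangements-complete (suc k) xs {x Vec.∷ w} (x∉w VecUnique.∷ w-unique) (x∈xs VecAll.∷ w⊆xs) =
    ∈-concatMap⁺ (λ y → map (y Vec.∷_) (arrangements k (xs without y))) {xs = xs}
      (Any.map (λ { refl → ∈-map⁺ (x Vec.∷_) (arrangements-complete k (xs without x) w-unique w⊆xs-x) }) x∈xs)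
    where
    w⊆xs-x : VecAll.All (_∈ xs without x) w
    w⊆xs-x = VecAll.map (λ (x≢y , y∈xs) → ∈-without⁺ y∈xs (λ y≡x → x≢y (sym y≡x))) (VecAll.zip (x∉w , w⊆xs))

-- The bubble-sort star graph

module SwapAt {n : ℕ} where

  lookup-swapAt : ∀ (u : Word n) i j k → Vec.lookup (swapAt u i j) k ≡ Vec.lookup u (transpose i j k)
  lookup-swapAt u i j k rewrite Vecₚ.lookup∘tabulate (λ k → if does (k Fin.≟ i) then Vec.lookup u j
                                  else (if does (k Fin.≟ j) then Vec.lookup u i else Vec.lookup u k)) k
    with does (k Fin.≟ i)
  ... | true  = refl
  ... | false with does (k Fin.≟ j)
  ...   | true  = refl
  ...   | false = refl

  transpose-matchˡ : ∀ (i j : Fin n) → transpose i j i ≡ j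
  transpose-matchˡ i j with i Fin.≟ i
  ... | yes _   = refl
  ... | no i≢i  = ⊥-elim (i≢i refl)

  transpose-matchʳ : ∀ (i j : Fin n) → transpose i j j ≡ i
  transpose-matchʳ i j with j Fin.≟ i
  ... | yes j≡i = j≡i
  ... | no _ with j Fin.≟ j
  ...   | yes _   = refl
  ...   | no j≢j  = ⊥-elim (j≢j refl)

  transpose-other : ∀ {i j k : Fin n} → k ≢ i → k ≢ j → transpose i j k ≡ k
  transpose-other {i} {j} {k} k≢i k≢j with k Fin.≟ i
  ... | yes k≡i = ⊥-elim (k≢i k≡i)
  ... | no _ with k Fin.≟ j
  ...   | yes k≡j = ⊥-elim (k≢j k≡j)
  ...   | no _    = refl

  transpose-involutive : ∀ (i j k : Fin n) → transpose i j (transpose i j k) ≡ k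
  transpose-involutive i j k with k Fin.≟ i
  ... | yes refl = transpose-matchʳ k j
  ... | no k≢i with k Fin.≟ j
  ...   | yes refl = transpose-matchˡ i k
  ...   | no k≢j   = transpose-other k≢i k≢j

  swapAt-involutive : ∀ (u : Word n) i j → swapAt (swapAt u i j) i j ≡ u
  swapAt-involutive u i j = begin
    swapAt (swapAt u i j) i j                             ≡⟨ Vecₚ.tabulate∘lookup (swapAt (swapAt u i j) i j) ⟨
    Vec.tabulate (Vec.lookup (swapAt (swapAt u i j) i j)) ≡⟨ Vecₚ.tabulate-cong lookup-twice ⟩
    Vec.tabulate (Vec.lookup u)                           ≡⟨ Vecₚ.tabulate∘lookup u ⟩
    u                                                     ∎
    where
    open ≡-Reasoning
    lookup-twice : ∀ k → Vec.lookup (swapAt (swapAt u i j) i j) k ≡ Vec.lookup u k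
    lookup-twice k = trans (lookup-swapAt (swapAt u i j) i j k)
                    (trans (lookup-swapAt u i j (transpose i j k)) (cong (Vec.lookup u) (transpose-involutive i j k)))

  swapAt-IsPerm : ∀ (u : Word n) i j → IsPerm u → IsPerm (swapAt u i j)
  swapAt-IsPerm u i j u-perm a b eq = begin
    a                               ≡⟨ transpose-involutive i j a ⟨
    transpose i j (transpose i j a) ≡⟨ cong (transpose i j) (u-perm _ _ lookups≡) ⟩
    transpose i j (transpose i j b) ≡⟨ transpose-involutive i j b ⟩
    b                               ∎
    where
    open ≡-Reasoning
    lookups≡ : Vec.lookup u (transpose i j a) ≡ Vec.lookup u (transpose i j b)
    lookups≡ = trans (sym (lookup-swapAt u i j a)) (trans eq (lookup-swapAt u i j b))

  swapAt-lookupˡ : ∀ (u : Word n) {i j i′ j′} → IsPerm u → swapAt u i j ≡ swapAt u i′ j′ → j ≡ transpose i′ j′ i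
  swapAt-lookupˡ u {i} {j} {i′} {j′} u-perm eq = u-perm _ _ (begin
    Vec.lookup u j                     ≡⟨ cong (Vec.lookup u) (transpose-matchˡ i j) ⟨
    Vec.lookup u (transpose i j i)     ≡⟨ lookup-swapAt u i j i ⟨
    Vec.lookup (swapAt u i j) i        ≡⟨ cong (λ v → Vec.lookup v i) eq ⟩
    Vec.lookup (swapAt u i′ j′) i      ≡⟨ lookup-swapAt u i′ j′ i ⟩
    Vec.lookup u (transpose i′ j′ i)   ∎)
    where open ≡-Reasoning

  swapAt-≢ : ∀ (u : Word n) {i j} → IsPerm u → i ≢ j → swapAt u i j ≢ u
  swapAt-≢ u {i} {j} u-perm i≢j eq =
    i≢j (u-perm i j (begin
      Vec.lookup u i                ≡⟨ cong (λ v → Vec.lookup v i) eq ⟨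
      Vec.lookup (swapAt u i j) i   ≡⟨ lookup-swapAt u i j i ⟩
      Vec.lookup u (transpose i j i) ≡⟨ cong (Vec.lookup u) (transpose-matchˡ i j) ⟩
      Vec.lookup u j                ∎))
    where open ≡-Reasoning

  swapAt-injective : ∀ (u : Word n) {i j i′ j′} → IsPerm u → toℕ i < toℕ j → toℕ i′ < toℕ j′ →
                     swapAt u i j ≡ swapAt u i′ j′ → i ≡ i′ × j ≡ j′
  swapAt-injective u {i} {j} {i′} {j′} u-perm i<j i′<j′ eq with i Fin.≟ i′
  ... | yes refl = refl , trans (swapAt-lookupˡ u u-perm eq) (transpose-matchˡ i j′)
  ... | no i≢i′ with i Fin.≟ j′
  ...   | yes refl = ⊥-elim (<-asym i<j (subst (λ z → toℕ z < toℕ i) (sym (trans (swapAt-lookupˡ u u-perm eq) (transpose-matchʳ i′ i))) i′<j′))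
  ...   | no i≢j′  = ⊥-elim (<-irrefl (cong toℕ (sym (trans (swapAt-lookupˡ u u-perm eq) (transpose-other i≢i′ i≢j′)))) i<j)

InT⇒< : ∀ {n} {i j : Fin n} → InT i j → toℕ i < toℕ j
InT⇒< {j = j} (inj₁ (i≡0 , 0<j)) = subst (_< toℕ j) (sym i≡0) 0<j
InT⇒< {i = i} (inj₂ (_ , j≡1+i)) = subst (toℕ i <_) (sym j≡1+i) ≤-refl

Linked⇒Walk : ∀ {n} {xs : List (Word n)} → Linked Adj xs → Walk xs
Linked⇒Walk []           = tt
Linked⇒Walk [-]          = tt
Linked⇒Walk (adj ∷ walk) = adj , Linked⇒Walk walk

module BubbleSortStar (m : ℕ) where

  n : ℕ
  n = 3 + m

  open SwapAt {n}

  𝒯 : List (Fin n × Fin n)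
  𝒯 = map (λ j → Fin.zero , Fin.suc j) (allFin (2 + m)) ++ map (λ i → Fin.suc (Fin.inject₁ i) , Fin.suc (Fin.suc i)) (allFin (1 + m))

  ∈𝒯⇒InT : ∀ {t} → t ∈ 𝒯 → InT (proj₁ t) (proj₂ t)
  ∈𝒯⇒InT t∈𝒯 with ∈-++⁻ (map (λ j → Fin.zero , Fin.suc j) (allFin (2 + m))) t∈𝒯
  ... | inj₁ t∈star with ∈-map⁻ _ t∈star
  ...   | j , _ , refl = inj₁ (refl , s≤s z≤n)
  ∈𝒯⇒InT t∈𝒯 | inj₂ t∈bubble with ∈-map⁻ _ t∈bubble
  ...   | i , _ , refl = inj₂ (s≤s z≤n , cong (suc ∘ suc) (sym (Finₚ.toℕ-inject₁ i)))

  𝒯-unique : Unique 𝒯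
  𝒯-unique = Unique.++⁺ (Unique.map⁺ (Finₚ.suc-injective ∘ cong proj₂) (Unique.allFin⁺ _))
                        (Unique.map⁺ (Finₚ.suc-injective ∘ Finₚ.suc-injective ∘ cong proj₂) (Unique.allFin⁺ _))
                        star∩bubble≡∅
    where
    star∩bubble≡∅ : Disjoint (map (λ j → Fin.zero , Fin.suc j) (allFin (2 + m))) (map (λ i → Fin.suc (Fin.inject₁ i) , Fin.suc (Fin.suc i)) (allFin (1 + m)))
    star∩bubble≡∅ (p , q) with ∈-map⁻ _ p | ∈-map⁻ _ q
    ... | _ , _ , refl | _ , _ , ()

  length-𝒯 : length 𝒯 ≡ 2 + (2 * m + 1)
  length-𝒯 = begin
    length 𝒯                 ≡⟨ length-++ (map (λ j → Fin.zero , Fin.suc j) (allFin (2 + m))) ⟩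
    _                        ≡⟨ cong₂ _+_ (trans (length-map _ (allFin (2 + m))) (length-tabulate {n = 2 + m} id))
                                          (trans (length-map _ (allFin (1 + m))) (length-tabulate {n = 1 + m} id)) ⟩
    (2 + m) + (1 + m)        ≡⟨ count m ⟩
    2 + (2 * m + 1)          ∎
    where
    open ≡-Reasoning
    count : ∀ m → (2 + m) + (1 + m) ≡ 2 + (2 * m + 1)
    count = solve-∀

  neighbours : Word n → List (Word n)
  neighbours u = map (uncurry (swapAt u)) 𝒯

  ∈neighbours⇒Adj : ∀ {u w} → w ∈ neighbours u → Adj u w
  ∈neighbours⇒Adj {u} w∈ with ∈-map⁻ (uncurry (swapAt u)) {xs = 𝒯} w∈
  ... | (i , j) , t∈𝒯 , refl = i , j , ∈𝒯⇒InT t∈𝒯 , refl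

  neighbours-sym : ∀ {u w} → w ∈ neighbours u → u ∈ neighbours w
  neighbours-sym {u} w∈ with ∈-map⁻ (uncurry (swapAt u)) {xs = 𝒯} w∈
  ... | (i , j) , t∈𝒯 , refl =
    subst (_∈ neighbours (swapAt u i j)) (swapAt-involutive u i j) (∈-map⁺ (uncurry (swapAt (swapAt u i j))) t∈𝒯)

  neighbours-IsPerm : ∀ u {w} → IsPerm u → w ∈ neighbours u → IsPerm w
  neighbours-IsPerm u u-perm w∈ with ∈-map⁻ (uncurry (swapAt u)) {xs = 𝒯} w∈
  ... | (i , j) , _ , refl = swapAt-IsPerm u i j u-perm

  neighbours-irreflexive : ∀ u → IsPerm u → u ∉ neighbours u
  neighbours-irreflexive u u-perm u∈ with ∈-map⁻ (uncurry (swapAt u)) {xs = 𝒯} u∈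
  ... | (i , j) , t∈𝒯 , u≡ = swapAt-≢ u u-perm (λ i≡j → <-irrefl (cong toℕ i≡j) (InT⇒< (∈𝒯⇒InT t∈𝒯))) (sym u≡)

  neighbours-unique : ∀ u → IsPerm u → Unique (neighbours u)
  neighbours-unique u u-perm = Unique-map⁺ injective-on-𝒯 𝒯-unique
    where
    injective-on-𝒯 : ∀ {s t} → s ∈ 𝒯 → t ∈ 𝒯 → uncurry (swapAt u) s ≡ uncurry (swapAt u) t → s ≡ t
    injective-on-𝒯 s∈𝒯 t∈𝒯 eq =
      let (i≡i′ , j≡j′) = swapAt-injective u u-perm (InT⇒< (∈𝒯⇒InT s∈𝒯)) (InT⇒< (∈𝒯⇒InT t∈𝒯)) eq
      in cong₂ _,_ i≡i′ j≡j′

  length-neighbours : ∀ u → length (neighbours u) ≡ 2 + (2 * m + 1)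
  length-neighbours u = trans (length-map (uncurry (swapAt u)) 𝒯) length-𝒯

  open Arrangements (Fin._≟_ {n})

  permutations : List (Word n)
  permutations = arrangements n (allFin n)

  length-permutations : length permutations ≡ n !
  length-permutations = length-arrangements n (allFin n) (Unique.allFin⁺ n) (length-tabulate {n = n} id)

  ∈permutations⇒IsPerm : ∀ {u} → u ∈ permutations → IsPerm u
  ∈permutations⇒IsPerm u∈ = VecUniqueₚ.lookup-injective (proj₁ (arrangements-sound n (allFin n) u∈))

  IsPerm⇒∈permutations : ∀ {u} → IsPerm u → u ∈ permutations
  IsPerm⇒∈permutations {u} u-perm =
    arrangements-complete n (allFin n) (lookup-injective⇒Unique u u-perm) (VecAllₚ.lookup⁻ (λ _ → ∈-allFin _))

  _≟ʷ_ : DecidableEquality (Word n)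
  _≟ʷ_ = Vecₚ.≡-dec Fin._≟_

  open DecidableLists _≟ʷ_ using (_∖_; ∈-∖⁻)
  open Graph _≟ʷ_ neighbours neighbours-sym using (Acyclic; module RegularGraph)

  no-cycle⇒acyclic : ∀ D → (∀ C → CycleAvoiding D C → ⊥) → Acyclic (permutations ∖ D)
  no-cycle⇒acyclic D no-cycle []       ()
  no-cycle⇒acyclic D no-cycle (v ∷ vs) (length≥3 , uniq , in-complement , linked) =
    no-cycle (v ∷ vs) (length≥3 , uniq ,
                       All.map (∈permutations⇒IsPerm ∘ proj₁ ∘ ∈-∖⁻ permutations) in-complement ,
                       All.map (proj₂ ∘ ∈-∖⁻ permutations) in-complement ,
                       Linked⇒Walk (Linked.map (λ {u} {w} → ∈neighbours⇒Adj {u} {w}) linked))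

  decycling-bound : ∀ D → IsDecyclingSet n D → n ! * (2 * m + 1) + 2 ≤ length D * (2 + 2 * (2 * m + 1))
  decycling-bound D ((_ , D-perm) , no-cycle) =
    subst (λ N → N * (2 * m + 1) + 2 ≤ length D * (2 + 2 * (2 * m + 1))) length-permutations
      (RegularGraph.decycling-bound permutations (arrangements-unique n (allFin n) (Unique.allFin⁺ n)) (2 * m + 1)
         (λ {u} u∈ u~w → IsPerm⇒∈permutations (neighbours-IsPerm u (∈permutations⇒IsPerm u∈) u~w))
         (λ {u} u∈ → neighbours-irreflexive u (∈permutations⇒IsPerm u∈))
         (λ {u} u∈ → neighbours-unique u (∈permutations⇒IsPerm u∈))
         (λ {u} _ → length-neighbours u)
         D (All.map (λ {u} → IsPerm⇒∈permutations {u}) D-perm)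
         (subst (0 <_) (sym length-permutations) (1≤n! n))
         (no-cycle⇒acyclic D no-cycle))

2*[3+m]∸5≡2*m+1 : ∀ m → 2 * (3 + m) ∸ 5 ≡ 2 * m + 1
2*[3+m]∸5≡2*m+1 m = trans (cong (_∸ 5) (expand m)) (m+n∸m≡n 5 (2 * m + 1))
  where
  expand : ∀ m → 2 * (3 + m) ≡ 5 + (2 * m + 1)
  expand = solve-∀

4*[3+m]∸8≡2+2*[2*m+1] : ∀ m → 4 * (3 + m) ∸ 8 ≡ 2 + 2 * (2 * m + 1)
4*[3+m]∸8≡2+2*[2*m+1] m = trans (cong (_∸ 8) (expand m)) (m+n∸m≡n 8 (2 + 2 * (2 * m + 1)))
  where
  expand : ∀ m → 4 * (3 + m) ≡ 8 + (2 + 2 * (2 * m + 1))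
  expand = solve-∀

corollary3p7 : (n d : ℕ) → 3 ≤ n → IsDecyclingNumber n d →
    (n !) * (2 * n ∸ 5) + 2 ≤ d * (4 * n ∸ 8)
corollary3p7 0             _ ()                   _
corollary3p7 1             _ (s≤s ())             _
corollary3p7 2             _ (s≤s (s≤s ()))       _
corollary3p7 (suc (suc (suc m))) .(length D) _ ((D , D-decycling , refl) , _) = begin
  (3 + m) ! * (2 * (3 + m) ∸ 5) + 2   ≡⟨ cong (λ k → (3 + m) ! * k + 2) (2*[3+m]∸5≡2*m+1 m) ⟩
  (3 + m) ! * (2 * m + 1) + 2         ≤⟨ BubbleSortStar.decycling-bound m D D-decycling ⟩
  length D * (2 + 2 * (2 * m + 1))    ≡⟨ cong (length D *_) (4*[3+m]∸8≡2+2*[2*m+1] m) ⟨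
  length D * (4 * (3 + m) ∸ 8)        ∎
  where open ≤-Reasoning
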